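{- For every rational number $q$, the sets $\Pi_s(q)$, $s=0,1,2,\dots$, are pairwise disjoint, and $\bigcup_{s=0}^{\infty}\Pi_s(q)=\Pi\setminus\mathcal D(q)$.
   Context: Chebyshev polynomials: $U_n\in\mathbb Z[q]$ are defined by $U_0=0$, $U_1=1$, $U_{n+1}=qU_n-U_{n-1}$ (equivalently, for every $2\times 2$ matrix $A$ of determinant $1$ and trace $q$, $A^n=U_n(q)A-U_{n-1}(q)I$); $C_n=U_{n+1}-U_{n-1}$ (so $C_0=2$, $C_1=q$, and $C_n(q)$ is the trace of $A^n$); for odd $n=2k+1$, $V_n=U_{k+1}-U_k$ and $W_n=U_{k+1}+U_k$. For a rational $q=a/b$ in lowest terms and a prime $p\nmid b$, "$x\equiv y \bmod p$" for rationals with denominators prime to $p$ means equality of their images in $\mathbb F_p$. $\mathcal D(q)$ is the set of prime divisors of the denominator $b$ of $q$. $\Pi$ is the set of odd primes. For $p\in\Pi\setminus\mathcal D(q)$: $p\in\Pi_0(q)$ if $W_n(q)\equiv 0 \bmod p$ for some odd $n\ge1$; $p\in\Pi_1(q)$ if $V_n(q)\equiv0\bmod p$ for some odd $n\ge1$; $p\in\Pi_{2+k}(q)$ ($k\ge0$) if $C_{2^kn}(q)\equiv0\bmod p$ for some odd $n\ge1$. -}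

module Defs where

open import Data.Nat as ℕ using (ℕ; zero; suc; _^_)
open import Data.Nat.Divisibility using (_∣_)
open import Data.Nat.Primality using (Prime)
open import Data.Integer as ℤ using (∣_∣)
open import Data.Rational using (ℚ; 0ℚ; 1ℚ; _+_; _*_; _-_; ↥_; ↧ₙ_)
open import Data.Product using (_×_; ∃)
open import Relation.Nullary using (¬_)
open import Relation.Binary.PropositionalEquality using (_≢_)

U : ℕ → ℚ → ℚ
U zero q = 0ℚ
U (suc zero) q = 1ℚ
U (suc (suc n)) q = q * U (suc n) q - U n q

C : ℕ → ℚ → ℚ
C zero q = 1ℚ + 1ℚ
C (suc n) q = U (suc (suc n)) q - U n q

-- For odd n = 2k+1 : V_n = U_{k+1} - U_k ,  W_n = U_{k+1} + U_k.
-- Vodd k q = V_{2k+1}(q),  Wodd k q = W_{2k+1}(q).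
Vodd : ℕ → ℚ → ℚ
Vodd k q = U (suc k) q - U k q

Wodd : ℕ → ℚ → ℚ
Wodd k q = U (suc k) q + U k q

-- x ≡ 0 mod p for a rational x whose (reduced) denominator is prime to p:
-- the image of x in 𝔽_p is zero iff p divides the reduced numerator.
ZeroMod : ℕ → ℚ → Set
ZeroMod p x = p ∣ ∣ ↥ x ∣

OddPrime : ℕ → Set
OddPrime p = Prime p × p ≢ 2

InD : ℚ → ℕ → Set
InD q p = p ∣ ↧ₙ q

Admissible : ℚ → ℕ → Set
Admissible q p = OddPrime p × ¬ InD q p

Pi : ℕ → ℚ → ℕ → Set
Pi zero q p = Admissible q p × ∃ λ k → ZeroMod p (Wodd k q)
Pi (suc zero) q p = Admissible q p × ∃ λ k → ZeroMod p (Vodd k q)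
Pi (suc (suc k)) q p = Admissible q p × ∃ λ m → ZeroMod p (C (2 ^ k ℕ.* suc (2 ℕ.* m)) q)

{-# OPTIONS --safe #-}
module Submission where

open import Defs
open import Data.Nat as ℕ using (ℕ; zero; suc; _^_; _<_; s≤s)
import Data.Nat.Properties as ℕ
open import Data.Nat.Induction using (<-rec)
open import Data.Nat.Tactic.RingSolver using (solve-∀)
open import Data.Integer.Tactic.RingSolver using () renaming (solve-∀ to ℤ-solve-∀)
open import Data.Nat.Primality using (Prime; prime⇒nonZero; euclidsLemma; prime[2]; ¬prime[1]; prime⇒irreducible)
import Data.Nat.Divisibility as ℕ
open import Data.Integer as ℤ using (ℤ; +_)
import Data.Integer.Properties as ℤ
open import Data.Integer.Divisibility.Signed
open import Data.Integer.DivMod using (_%ℕ_; _/ℕ_; n%ℕd<d; a≡a%ℕn+[a/ℕn]*n)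
open import Data.Rational using (ℚ; 0ℚ; 1ℚ; _+_; _*_; _-_; -_; ↥_; ↧_)
import Data.Rational.Properties as ℚ
open import Data.Rational.Solver using (module +-*-Solver)
open +-*-Solver
open import Data.Fin using (Fin; fromℕ<; toℕ; combine)
open import Data.Fin.Properties using (toℕ-fromℕ<; combine-injective; pigeonhole)
open import Data.Product using (_×_; _,_; proj₁; ∃; ∃₂; uncurry)
open import Data.Sum using (_⊎_; inj₁; inj₂; map; [_,_]′)
open import Data.Empty using (⊥; ⊥-elim)
open import Function.Base using (_∘_)
open import Function.Bundles using (_⇔_; mk⇔)
open import Relation.Nullary using (¬_)
open import Relation.Binary.Definitions using (tri<; tri≈; tri>)
open import Relation.Binary.PropositionalEquality
open ≡-Reasoning

-- Fix an odd prime p not dividing the denominator of q and compute in the ring of p-integral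
-- rationals.  Call (e , N) a period when U_{N+i} ≡ e U_i for all i.  The factorisations
-- U_{2k+1} = V_{2k+1} W_{2k+1}, U_{2k+2} - 1 = W_{2k+1} V_{2k+3}, U_{2k+2} + 1 = V_{2k+1} W_{2k+3},
-- U_{2n} = U_n C_n and U_{2n+1} + 1 = U_{n+1} C_n turn p ∈ Π_s into a period (+1 , 2^s · odd)
-- and, for s ≥ 1, a period (-1 , 2^(s-1) · odd).  For s < t both give periods at the common
-- multiple 2^(t-1) · odd, of opposite signs, which forces p ∣ 2.  Conversely the pairs
-- (U_n , U_{n+1}) mod p repeat, and since the recurrence can be run backwards some U_N with
-- N ≥ 1 vanishes; writing N = 2^k · odd and splitting U_N by the same factorisations puts p
-- in some Π_s.

2*n≡n+n : ∀ n → 2 ℕ.* n ≡ n ℕ.+ n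
2*n≡n+n n = cong (n ℕ.+_) (ℕ.+-identityʳ n)

2+2*n≡2*[1+n] : ∀ n → suc (suc (2 ℕ.* n)) ≡ 2 ℕ.* suc n
2+2*n≡2*[1+n] = solve-∀

parity : ∀ n → ∃ λ h → n ≡ 2 ℕ.* h ⊎ n ≡ suc (2 ℕ.* h)
parity zero = 0 , inj₁ refl
parity (suc n) with parity n
... | h , inj₁ refl = h , inj₂ refl
... | h , inj₂ refl = suc h , inj₁ (2+2*n≡2*[1+n] h)

TwoPowerTimesOdd : ℕ → Set
TwoPowerTimesOdd n = ∃₂ λ k m → n ≡ 2 ^ k ℕ.* suc (2 ℕ.* m)

twoPowerTimesOdd-suc : ∀ n → TwoPowerTimesOdd (suc n)
twoPowerTimesOdd-suc = <-rec _ split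
  where
  split : ∀ n → (∀ {h} → h < n → TwoPowerTimesOdd (suc h)) → TwoPowerTimesOdd (suc n)
  split n rec with parity n
  ... | h , inj₁ refl = 0 , h , sym (ℕ.*-identityˡ _)
  ... | h , inj₂ refl with k , m , eq ← rec (s≤s (ℕ.m≤m+n h (h ℕ.+ 0))) =
    suc k , m , trans (trans (2+2*n≡2*[1+n] h) (cong (2 ℕ.*_) eq)) (sym (ℕ.*-assoc 2 (2 ^ k) _))

module Localisation (p : ℕ) (p-prime : Prime p) where

  ∣*⇒∣⊎∣ : ∀ i j → + p ∣ i ℤ.* j → + p ∣ i ⊎ + p ∣ j
  ∣*⇒∣⊎∣ i j p∣ij
    with euclidsLemma ℤ.∣ i ∣ ℤ.∣ j ∣ p-prime (subst (p ℕ.∣_) (ℤ.abs-* i j) (∣⇒∣ᵤ p∣ij))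
  ... | inj₁ p∣i = inj₁ (∣ᵤ⇒∣ p∣i)
  ... | inj₂ p∣j = inj₂ (∣ᵤ⇒∣ p∣j)

  ∤*∤⇒∤* : ∀ {i j} → ¬ + p ∣ i → ¬ + p ∣ j → ¬ + p ∣ i ℤ.* j
  ∤*∤⇒∤* {i} {j} p∤i p∤j p∣ij with ∣*⇒∣⊎∣ i j p∣ij
  ... | inj₁ p∣i = p∤i p∣i
  ... | inj₂ p∣j = p∤j p∣j

  record Integral (x : ℚ) : Set where
    constructor integral
    field p∤↧ : ¬ + p ∣ ↧ x

  record Vanishes (x : ℚ) : Set where
    constructor vanishes
    field
      vanishes⇒integral : Integral x
      p∣↥ : + p ∣ ↥ x
  open Vanishes public using (p∣↥)

  -- g is the common factor cancelled when normalising, as in ℚ.↧-+ and ℚ.↧-*.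
  scaled-integral : ∀ x {g d} → ↧ x ℤ.* g ≡ d → ¬ + p ∣ d → Integral x
  scaled-integral x {g} refl p∤d = integral (p∤d ∘ ∣m⇒∣m*n g)

  scaled-vanishes : ∀ x {g n d} → ↥ x ℤ.* g ≡ n → ↧ x ℤ.* g ≡ d → ¬ + p ∣ d → + p ∣ n → Vanishes x
  scaled-vanishes x {g} refl refl p∤d p∣n = vanishes (scaled-integral x refl p∤d) p∣↥x
    where
    p∣↥x : + p ∣ ↥ x
    p∣↥x with ∣*⇒∣⊎∣ (↥ x) g p∣n
    ... | inj₁ p∣↥x = p∣↥x
    ... | inj₂ p∣g = ⊥-elim (p∤d (∣n⇒∣m*n (↧ x) p∣g))

  p∤1 : ¬ + p ∣ + 1
  p∤1 p∣1 = ¬prime[1] (subst Prime (ℕ.∣1⇒≡1 (∣⇒∣ᵤ p∣1)) p-prime)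

  integral-1 : Integral 1ℚ
  integral-1 = integral p∤1

  integral-0 : Integral 0ℚ
  integral-0 = integral p∤1

  vanishes-0 : Vanishes 0ℚ
  vanishes-0 = vanishes integral-0 (divides (+ 0) refl)

  integral-+ : ∀ {x y} → Integral x → Integral y → Integral (x + y)
  integral-+ {x} {y} (integral p∤↧x) (integral p∤↧y) =
    scaled-integral (x + y) (ℚ.↧-+ x y) (∤*∤⇒∤* p∤↧x p∤↧y)

  integral-* : ∀ {x y} → Integral x → Integral y → Integral (x * y)
  integral-* {x} {y} (integral p∤↧x) (integral p∤↧y) =
    scaled-integral (x * y) (ℚ.↧-* x y) (∤*∤⇒∤* p∤↧x p∤↧y)

  integral-neg : ∀ {x} → Integral x → Integral (- x)
  integral-neg {x} (integral p∤↧x) = integral (p∤↧x ∘ subst (+ p ∣_) (ℚ.↧-neg x))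

  integral-- : ∀ {x y} → Integral x → Integral y → Integral (x - y)
  integral-- ix iy = integral-+ ix (integral-neg iy)

  vanishes-+ : ∀ {x y} → Vanishes x → Vanishes y → Vanishes (x + y)
  vanishes-+ {x} {y} (vanishes (integral p∤↧x) p∣↥x) (vanishes (integral p∤↧y) p∣↥y) =
    scaled-vanishes (x + y) (ℚ.↥-+ x y) (ℚ.↧-+ x y) (∤*∤⇒∤* p∤↧x p∤↧y)
      (∣m∣n⇒∣m+n (∣m⇒∣m*n (↧ y) p∣↥x) (∣m⇒∣m*n (↧ x) p∣↥y))

  vanishes-neg : ∀ {x} → Vanishes x → Vanishes (- x)
  vanishes-neg {x} (vanishes ix p∣↥x) =
    vanishes (integral-neg ix) (subst (+ p ∣_) (sym (ℚ.↥-neg x)) (∣m⇒∣-m p∣↥x))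

  vanishes-- : ∀ {x y} → Vanishes x → Vanishes y → Vanishes (x - y)
  vanishes-- vx vy = vanishes-+ vx (vanishes-neg vy)

  vanishes-*ˡ : ∀ {x y} → Integral x → Vanishes y → Vanishes (x * y)
  vanishes-*ˡ {x} {y} (integral p∤↧x) (vanishes (integral p∤↧y) p∣↥y) =
    scaled-vanishes (x * y) (ℚ.↥-* x y) (ℚ.↧-* x y) (∤*∤⇒∤* p∤↧x p∤↧y) (∣n⇒∣m*n (↥ x) p∣↥y)

  vanishes-*ʳ : ∀ {x y} → Vanishes x → Integral y → Vanishes (x * y)
  vanishes-*ʳ {x} {y} (vanishes (integral p∤↧x) p∣↥x) (integral p∤↧y) =
    scaled-vanishes (x * y) (ℚ.↥-* x y) (ℚ.↧-* x y) (∤*∤⇒∤* p∤↧x p∤↧y) (∣m⇒∣m*n (↥ y) p∣↥x)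

  vanishes-*⇒vanishes⊎vanishes : ∀ {x y} → Integral x → Integral y → Vanishes (x * y) → Vanishes x ⊎ Vanishes y
  vanishes-*⇒vanishes⊎vanishes {x} {y} ix iy (vanishes _ p∣↥xy) =
    map (vanishes ix) (vanishes iy)
      (∣*⇒∣⊎∣ (↥ x) (↥ y) (subst (+ p ∣_) (ℚ.↥-* x y) (∣m⇒∣m*n _ p∣↥xy)))

  ¬vanishes-2 : p ≢ 2 → ¬ Vanishes (1ℚ + 1ℚ)
  ¬vanishes-2 p≢2 (vanishes _ p∣2) with prime⇒irreducible prime[2] (∣⇒∣ᵤ p∣2)
  ... | inj₁ p≡1 = ¬prime[1] (subst Prime p≡1 p-prime)
  ... | inj₂ p≡2 = p≢2 p≡2

  private instance
    p-nonZero : ℕ.NonZero p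
    p-nonZero = prime⇒nonZero p-prime

  residue : ℤ → Fin p
  residue i = fromℕ< (n%ℕd<d i p)

  residue-≡⇒∣- : ∀ i j → residue i ≡ residue j → + p ∣ i ℤ.- j
  residue-≡⇒∣- i j r≡r = divides (i /ℕ p ℤ.- j /ℕ p) (begin
    i ℤ.- j
      ≡⟨ cong₂ ℤ._-_ (a≡a%ℕn+[a/ℕn]*n i p) (a≡a%ℕn+[a/ℕn]*n j p) ⟩
    (+ (i %ℕ p) ℤ.+ i /ℕ p ℤ.* + p) ℤ.- (+ (j %ℕ p) ℤ.+ j /ℕ p ℤ.* + p)
      ≡⟨ cong (λ r → (+ (i %ℕ p) ℤ.+ i /ℕ p ℤ.* + p) ℤ.- (+ r ℤ.+ j /ℕ p ℤ.* + p)) (sym %≡%) ⟩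
    (+ (i %ℕ p) ℤ.+ i /ℕ p ℤ.* + p) ℤ.- (+ (i %ℕ p) ℤ.+ j /ℕ p ℤ.* + p)
      ≡⟨ cancel (+ (i %ℕ p)) (i /ℕ p) (j /ℕ p) (+ p) ⟩
    (i /ℕ p ℤ.- j /ℕ p) ℤ.* + p ∎)
    where
    %≡% : i %ℕ p ≡ j %ℕ p
    %≡% = trans (sym (toℕ-fromℕ< _)) (trans (cong toℕ r≡r) (toℕ-fromℕ< _))
    cancel : ∀ r a b n → (r ℤ.+ a ℤ.* n) ℤ.- (r ℤ.+ b ℤ.* n) ≡ (a ℤ.- b) ℤ.* n
    cancel = ℤ-solve-∀

  residues : ℚ → Fin (p ℕ.* p)
  residues x = combine (residue (↥ x)) (residue (↧ x))

  residues-≡⇒vanishes-- : ∀ {x y} → Integral x → Integral y → residues x ≡ residues y → Vanishes (x - y)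
  residues-≡⇒vanishes-- {x} {y} (integral p∤↧x) (integral p∤↧y) r≡r
    with combine-injective (residue (↥ x)) (residue (↧ x)) (residue (↥ y)) (residue (↧ y)) r≡r
  ... | ↥≡↥ , ↧≡↧ = scaled-vanishes (x - y) (ℚ.↥-+ x (- y)) (ℚ.↧-+ x (- y))
    (∤*∤⇒∤* p∤↧x (p∤↧y ∘ subst (+ p ∣_) (ℚ.↧-neg y)))
    (subst (+ p ∣_) (sym cross-difference)
      (∣m∣n⇒∣m-n (∣n⇒∣m*n (↧ x) (residue-≡⇒∣- (↥ x) (↥ y) ↥≡↥))
                 (∣n⇒∣m*n (↥ x) (residue-≡⇒∣- (↧ x) (↧ y) ↧≡↧))))
    where
    rearrange : ∀ a b c d → a ℤ.* d ℤ.+ ℤ.- c ℤ.* b ≡ b ℤ.* (a ℤ.- c) ℤ.- a ℤ.* (b ℤ.- d)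
    rearrange = ℤ-solve-∀
    cross-difference : ↥ x ℤ.* ↧ (- y) ℤ.+ ↥ (- y) ℤ.* ↧ x
                       ≡ ↧ x ℤ.* (↥ x ℤ.- ↥ y) ℤ.- ↥ x ℤ.* (↧ x ℤ.- ↧ y)
    cross-difference = trans (cong₂ (λ d n → ↥ x ℤ.* d ℤ.+ n ℤ.* ↧ x) (ℚ.↧-neg y) (ℚ.↥-neg y))
                             (rearrange (↥ x) (↧ x) (↥ y) (↧ y))

module Chebyshev (q : ℚ) where

  U-+ : ∀ a b → U (suc (a ℕ.+ b)) q ≡ U (suc a) q * U (suc b) q - U a q * U b q
  U-+ a zero = trans (cong (λ n → U (suc n) q) (ℕ.+-identityʳ a))
    (solve 2 (λ x y → x := x :* con 1ℚ :- y :* con 0ℚ) refl (U (suc a) q) (U a q))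
  U-+ a (suc zero) = trans (cong (λ n → U (suc n) q) (ℕ.+-comm a 1))
    (solve 3 (λ q x y → q :* x :- y := x :* (q :* con 1ℚ :- con 0ℚ) :- y :* con 1ℚ) refl q (U (suc a) q) (U a q))
  U-+ a (suc (suc b)) = begin
    U (suc (a ℕ.+ suc (suc b))) q
      ≡⟨ cong (λ n → U (suc n) q) (trans (ℕ.+-suc a (suc b)) (cong suc (ℕ.+-suc a b))) ⟩
    q * U (suc (suc (a ℕ.+ b))) q - U (suc (a ℕ.+ b)) q
      ≡⟨ cong₂ (λ s t → q * s - t)
           (trans (cong (λ n → U (suc n) q) (sym (ℕ.+-suc a b))) (U-+ a (suc b))) (U-+ a b) ⟩
    q * (U (suc a) q * U (suc (suc b)) q - U a q * U (suc b) q) - (U (suc a) q * U (suc b) q - U a q * U b q)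
      ≡⟨ solve 6 (λ q x₁ x₀ y₂ y₁ y₀ → q :* (x₁ :* y₂ :- x₀ :* y₁) :- (x₁ :* y₁ :- x₀ :* y₀)
                                      := x₁ :* (q :* y₂ :- y₁) :- x₀ :* (q :* y₁ :- y₀))
           refl q (U (suc a) q) (U a q) (U (suc (suc b)) q) (U (suc b) q) (U b q) ⟩
    U (suc a) q * U (suc (suc (suc b))) q - U a q * U (suc (suc b)) q ∎

  U-cassini : ∀ k → U (suc k) q * U (suc k) q - U k q * U (suc (suc k)) q ≡ 1ℚ
  U-cassini zero = solve 1 (λ q → con 1ℚ :* con 1ℚ :- con 0ℚ :* (q :* con 1ℚ :- con 0ℚ) := con 1ℚ) refl q
  U-cassini (suc k) = trans
    (solve 3 (λ q a b → (q :* a :- b) :* (q :* a :- b) :- a :* (q :* (q :* a :- b) :- a) := a :* a :- b :* (q :* a :- b))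
       refl q (U (suc k) q) (U k q))
    (U-cassini k)

  U-odd : ∀ k → U (suc (2 ℕ.* k)) q ≡ Vodd k q * Wodd k q
  U-odd k = begin
    U (suc (2 ℕ.* k)) q                    ≡⟨ cong (λ n → U (suc n) q) (2*n≡n+n k) ⟩
    U (suc (k ℕ.+ k)) q                    ≡⟨ U-+ k k ⟩
    U (suc k) q * U (suc k) q - U k q * U k q
      ≡⟨ solve 2 (λ a b → a :* a :- b :* b := (a :- b) :* (a :+ b)) refl (U (suc k) q) (U k q) ⟩
    Vodd k q * Wodd k q                    ∎

  U-odd-suc-1 : ∀ k → U (suc (suc (2 ℕ.* k))) q - 1ℚ ≡ Wodd k q * Vodd (suc k) q
  U-odd-suc-1 k = begin
    U (suc (suc (2 ℕ.* k))) q - 1ℚ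
      ≡⟨ cong₂ _-_ (trans (cong (λ n → U (suc (suc n)) q) (2*n≡n+n k)) (U-+ (suc k) k)) (sym (U-cassini k)) ⟩
    (c * b - b * a) - (b * b - a * c)
      ≡⟨ solve 3 (λ c b a → (c :* b :- b :* a) :- (b :* b :- a :* c) := (b :+ a) :* (c :- b)) refl c b a ⟩
    Wodd k q * Vodd (suc k) q ∎
    where c = U (suc (suc k)) q; b = U (suc k) q; a = U k q

  U-odd-suc+1 : ∀ k → U (suc (suc (2 ℕ.* k))) q + 1ℚ ≡ Vodd k q * Wodd (suc k) q
  U-odd-suc+1 k = begin
    U (suc (suc (2 ℕ.* k))) q + 1ℚ
      ≡⟨ cong₂ _+_ (trans (cong (λ n → U (suc (suc n)) q) (2*n≡n+n k)) (U-+ (suc k) k)) (sym (U-cassini k)) ⟩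
    (c * b - b * a) + (b * b - a * c)
      ≡⟨ solve 3 (λ c b a → (c :* b :- b :* a) :+ (b :* b :- a :* c) := (b :- a) :* (c :+ b)) refl c b a ⟩
    Vodd k q * Wodd (suc k) q ∎
    where c = U (suc (suc k)) q; b = U (suc k) q; a = U k q

  U-double : ∀ n → U (2 ℕ.* n) q ≡ U n q * C n q
  U-double zero = refl
  U-double (suc m) = begin
    U (2 ℕ.* suc m) q
      ≡⟨ cong (λ n → U n q) (trans (2*n≡n+n (suc m)) (cong suc (ℕ.+-suc m m))) ⟩
    U (suc (suc m ℕ.+ m)) q ≡⟨ U-+ (suc m) m ⟩
    c * b - b * a           ≡⟨ solve 3 (λ c b a → c :* b :- b :* a := b :* (c :- a)) refl c b a ⟩
    U (suc m) q * C (suc m) q ∎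
    where c = U (suc (suc m)) q; b = U (suc m) q; a = U m q

  U-double-suc+1 : ∀ n → U (suc (2 ℕ.* n)) q + 1ℚ ≡ U (suc n) q * C n q
  U-double-suc+1 zero = refl
  U-double-suc+1 (suc m) = begin
    U (suc (2 ℕ.* suc m)) q + 1ℚ
      ≡⟨ cong₂ _+_ (trans (cong (λ n → U (suc n) q) (2*n≡n+n (suc m))) (U-+ (suc m) (suc m)))
                   (sym (U-cassini m)) ⟩
    (c * c - b * b) + (b * b - a * c)
      ≡⟨ solve 3 (λ c b a → (c :* c :- b :* b) :+ (b :* b :- a :* c) := c :* (c :- a)) refl c b a ⟩
    U (suc (suc m)) q * C (suc m) q ∎
    where c = U (suc (suc m)) q; b = U (suc m) q; a = U m q

module Periods (p : ℕ) (p-prime : Prime p) (q : ℚ) (q-integral : Localisation.Integral p p-prime q) where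
  open Localisation p p-prime
  open Chebyshev q

  U-integral : ∀ n → Integral (U n q)
  U-integral zero = integral-0
  U-integral (suc zero) = integral-1
  U-integral (suc (suc n)) = integral-- (integral-* q-integral (U-integral (suc n))) (U-integral n)

  vanishes-recurrence : (f : ℕ → ℚ) → (∀ n → f (suc (suc n)) ≡ q * f (suc n) - f n) →
                        Vanishes (f 0) → Vanishes (f 1) → ∀ n → Vanishes (f n)
  vanishes-recurrence f rec v₀ v₁ zero = v₀
  vanishes-recurrence f rec v₀ v₁ (suc zero) = v₁
  vanishes-recurrence f rec v₀ v₁ (suc (suc n)) = subst Vanishes (sym (rec n))
    (vanishes-- (vanishes-*ˡ q-integral (vanishes-recurrence f rec v₀ v₁ (suc n)))
                (vanishes-recurrence f rec v₀ v₁ n))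

  -- A period (e , N) amounts to A ^ N ≡ e · I modulo p, for A any matrix of trace q and determinant 1.
  record Period (e : ℚ) (N : ℕ) : Set where
    constructor period
    field shift : ∀ i → Vanishes (U (N ℕ.+ i) q - e * U i q)

  period-intro : ∀ {e N} → Vanishes (U N q) → Vanishes (U (suc N) q - e) → Period e N
  period-intro {e} {N} v₀ v₁ = period (vanishes-recurrence f rec
      (subst Vanishes f₀ v₀) (subst Vanishes f₁ v₁))
    where
    f : ℕ → ℚ
    f i = U (N ℕ.+ i) q - e * U i q
    rec : ∀ n → f (suc (suc n)) ≡ q * f (suc n) - f n
    rec n = begin
      U (N ℕ.+ suc (suc n)) q - e * U (suc (suc n)) q
        ≡⟨ cong (λ m → U m q - e * U (suc (suc n)) q) (trans (ℕ.+-suc N (suc n)) (cong suc (ℕ.+-suc N n))) ⟩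
      (q * U (suc (N ℕ.+ n)) q - U (N ℕ.+ n) q) - e * (q * U (suc n) q - U n q)
        ≡⟨ cong (λ m → (q * U m q - U (N ℕ.+ n) q) - e * (q * U (suc n) q - U n q)) (sym (ℕ.+-suc N n)) ⟩
      (q * U (N ℕ.+ suc n) q - U (N ℕ.+ n) q) - e * (q * U (suc n) q - U n q)
        ≡⟨ solve 6 (λ q e a b c d → (q :* a :- b) :- e :* (q :* c :- d) := q :* (a :- e :* c) :- (b :- e :* d))
             refl q e (U (N ℕ.+ suc n) q) (U (N ℕ.+ n) q) (U (suc n) q) (U n q) ⟩
      q * f (suc n) - f n ∎
    f₀ : U N q ≡ f 0
    f₀ = trans (cong (λ m → U m q) (sym (ℕ.+-identityʳ N)))
      (solve 2 (λ x e → x := x :- e :* con 0ℚ) refl (U (N ℕ.+ 0) q) e)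
    f₁ : U (suc N) q - e ≡ f 1
    f₁ = trans (cong (λ m → U m q - e) (ℕ.+-comm 1 N))
      (solve 2 (λ x e → x :- e := x :- e :* con 1ℚ) refl (U (N ℕ.+ 1) q) e)

  period-0 : Period 1ℚ 0
  period-0 = period λ i → subst Vanishes (sym (solve 1 (λ x → x :- con 1ℚ :* x := con 0ℚ) refl (U i q))) vanishes-0

  period-+ : ∀ {e d a b} → Integral e → Period e a → Period d b → Period (e * d) (a ℕ.+ b)
  period-+ {e} {d} {a} {b} e-integral (period shiftᵃ) (period shiftᵇ) = period λ i →
    subst Vanishes (split i) (vanishes-+ (shiftᵃ (b ℕ.+ i)) (vanishes-*ˡ e-integral (shiftᵇ i)))
    where
    split : ∀ i → (U (a ℕ.+ (b ℕ.+ i)) q - e * U (b ℕ.+ i) q) + e * (U (b ℕ.+ i) q - d * U i q)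
                  ≡ U (a ℕ.+ b ℕ.+ i) q - e * d * U i q
    split i = trans
      (cong (λ m → (U m q - e * U (b ℕ.+ i) q) + e * (U (b ℕ.+ i) q - d * U i q)) (sym (ℕ.+-assoc a b i)))
      (solve 5 (λ x w y e d → (x :- e :* w) :+ e :* (w :- d :* y) := x :- e :* d :* y)
         refl (U (a ℕ.+ b ℕ.+ i) q) (U (b ℕ.+ i) q) (U i q) e d)

  period-*ʳ : ∀ {N} → Period 1ℚ N → ∀ c → Period 1ℚ (N ℕ.* c)
  period-*ʳ {N} _ zero = subst (Period 1ℚ) (sym (ℕ.*-zeroʳ N)) period-0
  period-*ʳ {N} per (suc c) = subst (Period 1ℚ) (sym (ℕ.*-suc N c)) (period-+ integral-1 per (period-*ʳ per c))

  period-double : ∀ {N} → Period (- 1ℚ) N → Period 1ℚ (2 ℕ.* N)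
  period-double {N} per = subst (Period 1ℚ) (sym (2*n≡n+n N)) (period-+ (integral-neg integral-1) per per)

  period-*-odd : ∀ {N} → Period (- 1ℚ) N → ∀ m → Period (- 1ℚ) (N ℕ.* suc (2 ℕ.* m))
  period-*-odd {N} per m = subst (Period (- 1ℚ)) (odd-multiple N m)
    (period-+ integral-1 (period-*ʳ (period-double per) m) per)
    where
    odd-multiple : ∀ N m → 2 ℕ.* N ℕ.* m ℕ.+ N ≡ N ℕ.* suc (2 ℕ.* m)
    odd-multiple = solve-∀

  period-sign-clash : p ≢ 2 → ∀ {N} → Period 1ℚ N → Period (- 1ℚ) N → ⊥
  period-sign-clash p≢2 {N} (period shift⁺) (period shift⁻) =
    ¬vanishes-2 p≢2 (subst Vanishes two (vanishes-- (shift⁻ 1) (shift⁺ 1)))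
    where
    two : (U (N ℕ.+ 1) q - - 1ℚ * 1ℚ) - (U (N ℕ.+ 1) q - 1ℚ * 1ℚ) ≡ 1ℚ + 1ℚ
    two = solve 1 (λ x → (x :- (:- con 1ℚ) :* con 1ℚ) :- (x :- con 1ℚ :* con 1ℚ) := con 1ℚ :+ con 1ℚ)
            refl (U (N ℕ.+ 1) q)

  V-integral : ∀ k → Integral (Vodd k q)
  V-integral k = integral-- (U-integral (suc k)) (U-integral k)

  W-integral : ∀ k → Integral (Wodd k q)
  W-integral k = integral-+ (U-integral (suc k)) (U-integral k)

  C-integral : ∀ n → Integral (C n q)
  C-integral zero = integral-+ integral-1 integral-1
  C-integral (suc n) = integral-- (U-integral (suc (suc n))) (U-integral n)

  W-vanishes⇒period : ∀ k → Vanishes (Wodd k q) → Period 1ℚ (suc (2 ℕ.* k))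
  W-vanishes⇒period k vW = period-intro
    (subst Vanishes (sym (U-odd k)) (vanishes-*ˡ (V-integral k) vW))
    (subst Vanishes (sym (U-odd-suc-1 k)) (vanishes-*ʳ vW (V-integral (suc k))))

  V-vanishes⇒period : ∀ k → Vanishes (Vodd k q) → Period (- 1ℚ) (suc (2 ℕ.* k))
  V-vanishes⇒period k vV = period-intro
    (subst Vanishes (sym (U-odd k)) (vanishes-*ʳ vV (W-integral k)))
    (subst Vanishes (sym (U-odd-suc+1 k)) (vanishes-*ʳ vV (W-integral (suc k))))

  C-vanishes⇒period : ∀ n → Vanishes (C n q) → Period (- 1ℚ) (2 ℕ.* n)
  C-vanishes⇒period n vC = period-intro
    (subst Vanishes (sym (U-double n)) (vanishes-*ˡ (U-integral n) vC))
    (subst Vanishes (sym (U-double-suc+1 n)) (vanishes-*ˡ (U-integral (suc n)) vC))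

  Agree : ℕ → ℕ → Set
  Agree i j = Vanishes (U i q - U j q) × Vanishes (U (suc i) q - U (suc j) q)

  agree-pred : ∀ {i j} → Agree (suc i) (suc j) → Agree i j
  agree-pred {i} {j} (vᵢ₊₁ , vᵢ₊₂) =
    subst Vanishes step (vanishes-- (vanishes-*ˡ q-integral vᵢ₊₁) vᵢ₊₂) , vᵢ₊₁
    where
    step : q * (U (suc i) q - U (suc j) q) - (U (suc (suc i)) q - U (suc (suc j)) q) ≡ U i q - U j q
    step = solve 5 (λ q a b c d → q :* (a :- b) :- ((q :* a :- c) :- (q :* b :- d)) := c :- d)
      refl q (U (suc i) q) (U (suc j) q) (U i q) (U j q)

  agree-zero : ∀ i N → Agree i (i ℕ.+ N) → Agree 0 N
  agree-zero zero N a = a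
  agree-zero (suc i) N a = agree-zero i N (agree-pred {i} {i ℕ.+ N} a)

  U-residues : ℕ → Fin (p ℕ.* p ℕ.* (p ℕ.* p))
  U-residues n = combine (residues (U n q)) (residues (U (suc n) q))

  U-residues-≡⇒agree : ∀ i j → U-residues i ≡ U-residues j → Agree i j
  U-residues-≡⇒agree i j codes≡
    with r₀ , r₁ ← combine-injective (residues (U i q)) (residues (U (suc i) q)) _ _ codes≡ =
    residues-≡⇒vanishes-- (U-integral i) (U-integral j) r₀ ,
    residues-≡⇒vanishes-- (U-integral (suc i)) (U-integral (suc j)) r₁

  U-vanishes-somewhere : ∃ λ N → Vanishes (U (suc N) q)
  U-vanishes-somewhere
    with i , j , i<j , codes≡ ← pigeonhole (ℕ.n<1+n (p ℕ.* p ℕ.* (p ℕ.* p))) (U-residues ∘ toℕ)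
    with d , i+1+d≡j ← ℕ.m≤n⇒∃[o]m+o≡n i<j
    with v₀ , _ ← agree-zero (toℕ i) (suc d)
           (subst (Agree (toℕ i)) (trans (sym i+1+d≡j) (sym (ℕ.+-suc (toℕ i) d)))
              (U-residues-≡⇒agree (toℕ i) (toℕ j) codes≡))
    = d , subst Vanishes (solve 1 (λ x → :- (con 0ℚ :- x) := x) refl (U (suc d) q)) (vanishes-neg v₀)

module Membership (q : ℚ) (p : ℕ) (p-prime : Prime p) (p≢2 : p ≢ 2) (p∤↧q : ¬ InD q p) where
  open Localisation p p-prime
  open Chebyshev q

  q-integral : Integral q
  q-integral = integral (p∤↧q ∘ ∣⇒∣ᵤ)

  open Periods p p-prime q q-integral

  admissible : Admissible q p
  admissible = (p-prime , p≢2) , p∤↧q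

  zeroMod⇒vanishes : ∀ {x} → Integral x → ZeroMod p x → Vanishes x
  zeroMod⇒vanishes ix z = vanishes ix (∣ᵤ⇒∣ z)

  Pi-suc⇒period⁻ : ∀ t → Pi (suc t) q p → ∃ λ m → Period (- 1ℚ) (2 ^ t ℕ.* suc (2 ℕ.* m))
  Pi-suc⇒period⁻ zero (_ , m , v) =
    m , subst (Period (- 1ℚ)) (sym (ℕ.*-identityˡ _)) (V-vanishes⇒period m (zeroMod⇒vanishes (V-integral m) v))
  Pi-suc⇒period⁻ (suc k) (_ , m , c) =
    m , subst (Period (- 1ℚ)) (sym (ℕ.*-assoc 2 (2 ^ k) _)) (C-vanishes⇒period n (zeroMod⇒vanishes (C-integral n) c))
    where n = 2 ^ k ℕ.* suc (2 ℕ.* m)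

  Pi⇒period⁺ : ∀ s → Pi s q p → ∃ λ m → Period 1ℚ (2 ^ s ℕ.* suc (2 ℕ.* m))
  Pi⇒period⁺ zero (_ , m , w) =
    m , subst (Period 1ℚ) (sym (ℕ.*-identityˡ _)) (W-vanishes⇒period m (zeroMod⇒vanishes (W-integral m) w))
  Pi⇒period⁺ (suc t) π with m , per ← Pi-suc⇒period⁻ t π =
    m , subst (Period 1ℚ) (sym (ℕ.*-assoc 2 (2 ^ t) _)) (period-double per)

  Pi-<-disjoint : ∀ {s t} → s < t → Pi s q p → Pi t q p → ⊥
  Pi-<-disjoint {s} {suc t} (s≤s s≤t) πₛ πₜ
    with m , per⁺ ← Pi⇒period⁺ s πₛ | m′ , per⁻ ← Pi-suc⇒period⁻ t πₜ | d , refl ← ℕ.m≤n⇒∃[o]m+o≡n s≤t =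
    period-sign-clash p≢2
      (subst (Period 1ℚ) common (period-*ʳ per⁺ (2 ^ d ℕ.* suc (2 ℕ.* m′))))
      (period-*-odd per⁻ m)
    where
    rearrange : ∀ a b o o′ → a ℕ.* o ℕ.* (b ℕ.* o′) ≡ a ℕ.* b ℕ.* o′ ℕ.* o
    rearrange = solve-∀
    common : 2 ^ s ℕ.* suc (2 ℕ.* m) ℕ.* (2 ^ d ℕ.* suc (2 ℕ.* m′))
             ≡ 2 ^ (s ℕ.+ d) ℕ.* suc (2 ℕ.* m′) ℕ.* suc (2 ℕ.* m)
    common = trans (rearrange (2 ^ s) (2 ^ d) _ _)
      (cong (λ a → a ℕ.* suc (2 ℕ.* m′) ℕ.* suc (2 ℕ.* m)) (sym (ℕ.^-distribˡ-+-* 2 s d)))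

  Pi-disjoint : ∀ s t → s ≢ t → Pi s q p → Pi t q p → ⊥
  Pi-disjoint s t s≢t πₛ πₜ with ℕ.<-cmp s t
  ... | tri< s<t _ _ = Pi-<-disjoint s<t πₛ πₜ
  ... | tri≈ _ s≡t _ = s≢t s≡t
  ... | tri> _ _ t<s = Pi-<-disjoint t<s πₜ πₛ

  U-vanishes⇒Pi : ∀ k m → Vanishes (U (2 ^ k ℕ.* suc (2 ℕ.* m)) q) → ∃ λ s → Pi s q p
  U-vanishes⇒Pi zero m v =
    [ (λ vV → 1 , admissible , m , ∣⇒∣ᵤ (p∣↥ vV)) , (λ vW → 0 , admissible , m , ∣⇒∣ᵤ (p∣↥ vW)) ]′
    (vanishes-*⇒vanishes⊎vanishes (V-integral m) (W-integral m)
       (subst Vanishes (trans (cong (λ n → U n q) (ℕ.*-identityˡ (suc (2 ℕ.* m)))) (U-odd m)) v))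
  U-vanishes⇒Pi (suc k) m v = [ U-vanishes⇒Pi k m , (λ vC → suc (suc k) , admissible , m , ∣⇒∣ᵤ (p∣↥ vC)) ]′
    (vanishes-*⇒vanishes⊎vanishes (U-integral n) (C-integral n)
       (subst Vanishes (trans (cong (λ n → U n q) (ℕ.*-assoc 2 (2 ^ k) (suc (2 ℕ.* m)))) (U-double n)) v))
    where n = 2 ^ k ℕ.* suc (2 ℕ.* m)

  U-suc-vanishes⇒Pi : ∀ N → Vanishes (U (suc N) q) → ∃ λ s → Pi s q p
  U-suc-vanishes⇒Pi N v with k , m , eq ← twoPowerTimesOdd-suc N = U-vanishes⇒Pi k m (subst (λ n → Vanishes (U n q)) eq v)

  in-some-Pi : ∃ λ s → Pi s q p
  in-some-Pi = uncurry U-suc-vanishes⇒Pi U-vanishes-somewhere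

Pi⇒admissible : ∀ {q p} s → Pi s q p → Admissible q p
Pi⇒admissible zero = proj₁
Pi⇒admissible (suc zero) = proj₁
Pi⇒admissible (suc (suc _)) = proj₁

theorem1 : (q : ℚ) →
    ((s t p : ℕ) → s ≢ t → Pi s q p → Pi t q p → ⊥)
    × ((p : ℕ) → (∃ λ s → Pi s q p) ⇔ Admissible q p)
theorem1 q = disjoint , λ p → mk⇔ (uncurry Pi⇒admissible) (in-some-Pi p)
  where
  in-some-Pi : ∀ p → Admissible q p → ∃ λ s → Pi s q p
  in-some-Pi p ((p-prime , p≢2) , p∤↧q) = Membership.in-some-Pi q p p-prime p≢2 p∤↧q
  disjoint : (s t p : ℕ) → s ≢ t → Pi s q p → Pi t q p → ⊥
  disjoint s t p s≢t πₛ with (p-prime , p≢2) , p∤↧q ← Pi⇒admissible s πₛ =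
    Membership.Pi-disjoint q p p-prime p≢2 p∤↧q s t s≢t πₛ
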